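{- Let $G$ be a finite connected graph with maximum degree $\Delta$ such that $C(G)\neq\emptyset$, and let $f:V(G)\to\{ -1,1\}$ be a signed dominating function of $G$. Let $V^{+}=\{v: f(v)=1\}$, $V^{ - }=\{v: f(v)=-1\}$, let $E^{+}$ and $E^{ - }$ be the numbers of edges of the subgraphs induced by $V^{+}$ and $V^{ - }$ respectively, let $[V^{+},V^{ - }]$ be the set of edges with one endpoint in $V^{+}$ and the other in $V^{ - }$, let $L$ be the set of vertices of degree $1$, and let $V_o$ be the set of vertices of odd degree. Then (i) $\left(\left\lceil \frac{\delta^{*}}{2}\right\rceil+1\right)|V^{ - }| \leq |[V^{+},V^{ - }]|\leq \left\lfloor\frac{\Delta}{2}\right\rfloor\,|V^{+}\setminus L|$; (ii) $|V_{o}|+2|V^{ - }|\leq 2E^{+}-2E^{ - }$.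
   Context: A signed dominating function (SDF) of $G$ is a function $f:V(G)\to\{ -1,1\}$ with $f(N[v])=\sum_{u\in N[v]}f(u)\geq 1$ for every vertex $v$, where $N[v]$ is the closed neighborhood. Let $O$ be the set of isolated vertices, $L$ the set of leaves (degree-$1$ vertices), $S$ the set of support vertices (vertices adjacent to a leaf), $C(G)=V(G)\setminus(O\cup L\cup S)$, and, when $C(G)\neq\emptyset$, $\delta^{*}=\min\{\deg(v): v\in C(G)\}$. -}

module Defs where

open import Data.Nat using (ℕ; zero; suc; _≤_; _⊔_; _∸_; _+_; _*_; ⌊_/2⌋; ⌈_/2⌉)
open import Data.Nat.Properties using (_≟_)
open import Data.Bool using (Bool; true; false; _∧_; _∨_; not; if_then_else_)
open import Data.Fin using (Fin; _<?_) renaming (_≟_ to _≟ᶠ_)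
open import Data.List using (List; length; filter; map; foldr; allFin)
open import Data.Nat.ListAction using (sum)
open import Data.Integer using (ℤ; +_; -[1+_]) renaming (_+_ to _+ℤ_; _≟_ to _≟ℤ_)
open import Data.Product using (Σ; ∃; _×_; _,_)
open import Data.Sum using (_⊎_)
open import Relation.Nullary using (¬_; does)
open import Relation.Binary.PropositionalEquality using (_≡_)

record Graph (n : ℕ) : Set where
  field
    adj    : Fin n → Fin n → Bool
    sym    : ∀ u v → adj u v ≡ adj v u
    irrefl : ∀ v → adj v v ≡ false

open Graph public

count : {n : ℕ} → (Fin n → Bool) → ℕ
count {n} p = length (filter (λ v → p v Data.Bool.≟ true) (allFin n))

count₂ : {n : ℕ} → (Fin n → Fin n → Bool) → ℕ
count₂ {n} p = sum (map (λ u → count (p u)) (allFin n))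

degree : {n : ℕ} → Graph n → Fin n → ℕ
degree G v = count (adj G v)

-- maximum degree Δ(G) (0 for the empty graph)
maxDegree : {n : ℕ} → Graph n → ℕ
maxDegree {n} G = foldr _⊔_ 0 (map (degree G) (allFin n))

data Reach {n : ℕ} (G : Graph n) : Fin n → Fin n → Set where
  here : ∀ {u} → Reach G u u
  step : ∀ {u v w} → adj G u v ≡ true → Reach G v w → Reach G u w

Connected : {n : ℕ} → Graph n → Set
Connected {n} G = ∀ (u v : Fin n) → Reach G u v

IsIsolated : {n : ℕ} → Graph n → Fin n → Set
IsIsolated G v = degree G v ≡ 0

IsLeaf : {n : ℕ} → Graph n → Fin n → Set
IsLeaf G v = degree G v ≡ 1

IsSupport : {n : ℕ} → Graph n → Fin n → Set
IsSupport G v = ∃ λ u → adj G v u ≡ true × IsLeaf G u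

InC : {n : ℕ} → Graph n → Fin n → Set
InC G v = ¬ IsIsolated G v × ¬ IsLeaf G v × ¬ IsSupport G v

IsDeltaStar : {n : ℕ} → Graph n → ℕ → Set
IsDeltaStar {n} G δ =
  (∃ λ v → InC G v × degree G v ≡ δ) × (∀ (w : Fin n) → InC G w → δ ≤ degree G w)

closedNbhdSum : {n : ℕ} → Graph n → (Fin n → ℤ) → Fin n → ℤ
closedNbhdSum {n} G f v =
  foldr _+ℤ_ (+ 0)
    (map (λ u → if (does (u ≟ᶠ v) ∨ adj G v u) then f u else + 0) (allFin n))

IsSDF : {n : ℕ} → Graph n → (Fin n → ℤ) → Set
IsSDF {n} G f =
  (∀ (v : Fin n) → f v ≡ + 1 ⊎ f v ≡ -[1+ 0 ]) ×
  (∀ (v : Fin n) → + 1 Data.Integer.≤ closedNbhdSum G f v)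

isPlus : {n : ℕ} → (Fin n → ℤ) → Fin n → Bool
isPlus f v = does (f v ≟ℤ + 1)

isMinus : {n : ℕ} → (Fin n → ℤ) → Fin n → Bool
isMinus f v = does (f v ≟ℤ -[1+ 0 ])

isLeafB : {n : ℕ} → Graph n → Fin n → Bool
isLeafB G v = does (degree G v ≟ 1)

isOddB : {n : ℕ} → Graph n → Fin n → Bool
isOddB G v = does (Data.Nat._%_ (degree G v) 2 ≟ 1)

nPlus nMinus : {n : ℕ} → (Fin n → ℤ) → ℕ
nPlus f = count (isPlus f)
nMinus f = count (isMinus f)

nPlusNonLeaf : {n : ℕ} → Graph n → (Fin n → ℤ) → ℕ
nPlusNonLeaf G f = count (λ v → isPlus f v ∧ not (isLeafB G v))

nOdd : {n : ℕ} → Graph n → ℕ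
nOdd G = count (isOddB G)

-- E⁺, E⁻: number of edges {u,v} (counted once, via u < v) inside V⁺ resp. V⁻
ePlus eMinus : {n : ℕ} → Graph n → (Fin n → ℤ) → ℕ
ePlus G f = count₂ (λ u v → does (u <? v) ∧ adj G u v ∧ isPlus f u ∧ isPlus f v)
eMinus G f = count₂ (λ u v → does (u <? v) ∧ adj G u v ∧ isMinus f u ∧ isMinus f v)

-- |[V⁺,V⁻]|: edges with one end in V⁺ and the other in V⁻ (oriented u ∈ V⁺, v ∈ V⁻)
cutSize : {n : ℕ} → Graph n → (Fin n → ℤ) → ℕ
cutSize G f = count₂ (λ u v → adj G u v ∧ isPlus f u ∧ isMinus f v)

module Submission where

-- Write d⁺ v and d⁻ v for the numbers of neighbours of v in V⁺ and V⁻.  Since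
-- f(N[v]) = f(v) + d⁺ v − d⁻ v ≥ 1, we get d⁻ v ≤ d⁺ v everywhere and
-- d⁻ v + 2 ≤ d⁺ v on V⁻.  Hence every vertex of V⁻ lies in C(G), so
-- d⁺ v ≥ ⌈δ*/2⌉ + 1 on V⁻, while d⁻ u ≤ ⌊deg u / 2⌋ on V⁺ and d⁻ vanishes on
-- leaves; as |[V⁺,V⁻]| is both the sum of d⁺ over V⁻ and of d⁻ over V⁺, this
-- gives (i).  The slack d⁺ v − d⁻ v − 2[v ∈ V⁻] has the parity of deg v, so it
-- is at least 1 on V_o; summing over all v, with Σ d⁺ = 2E⁺ + |[V⁺,V⁻]| and
-- Σ d⁻ = |[V⁺,V⁻]| + 2E⁻, gives (ii).

open import Data.Bool using (Bool; true; false; _∧_; _∨_; not; if_then_else_) renaming (_≟_ to _≟ᵇ_)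
open import Data.Bool.Properties using (∧-comm)
open import Data.Fin using (Fin; zero; suc; _<?_) renaming (_≟_ to _≟ᶠ_)
import Data.Fin.Properties as FinP
open import Data.Integer using (ℤ; +_; -[1+_]; +≤+) renaming (_≤_ to _≤ℤ_; _+_ to _+ℤ_; _-_ to _-ℤ_; _*_ to _*ℤ_; _≟_ to _≟ℤ_)
import Data.Integer.Properties as ℤ
open import Data.List using (List; []; _∷_)
import Data.List as List
open import Data.List.Properties using (map-tabulate)
open import Data.Nat using (ℕ; zero; suc; _≤_; _<_; _+_; _*_; _⊔_; _%_; _≟_; z≤n; s≤s; ⌊_/2⌋; ⌈_/2⌉)
open import Data.Nat.DivMod using (m*n%n≡0)
open import Data.Nat.Properties hiding (_<?_)
open import Data.Nat.Tactic.RingSolver using (solve)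
open import Data.Product using (_×_; _,_; proj₁; proj₂; ∃)
open import Data.Sum using (_⊎_; inj₁; inj₂)
import Data.Vec.Functional as Vector
open import Function using (_∘_; id)
open import Relation.Binary.Definitions using (tri<; tri≈; tri>)
open import Relation.Binary.PropositionalEquality
open import Relation.Nullary using (Dec; does; yes; no; contradiction)
open import Relation.Nullary.Decidable using (dec-true; dec-false)

open import Algebra.Properties.Semiring.Sum +-*-semiring
import Algebra.Properties.CommutativeMonoid.Sum ℤ.+-0-commutativeMonoid as ℤΣ
open import Defs hiding (sym)

𝟙 : Bool → ℕ
𝟙 true  = 1
𝟙 false = 0

𝟙-∧ : ∀ a b → 𝟙 (a ∧ b) ≡ 𝟙 a * 𝟙 b
𝟙-∧ true  b = sym (+-identityʳ (𝟙 b))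
𝟙-∧ false b = refl

𝟙-∧-middle : ∀ a b c → 𝟙 (a ∧ b ∧ c) ≡ 𝟙 b * 𝟙 (a ∧ c)
𝟙-∧-middle false false c = refl
𝟙-∧-middle false true  c = refl
𝟙-∧-middle true  false c = refl
𝟙-∧-middle true  true  c = sym (+-identityʳ (𝟙 c))

𝟙*-mono : ∀ b {x y} → (b ≡ true → x ≤ y) → 𝟙 b * x ≤ 𝟙 b * y
𝟙*-mono true  x≤y = +-monoˡ-≤ 0 (x≤y refl)
𝟙*-mono false _   = z≤n

Partition : ∀ {n} → (Fin n → Bool) → (Fin n → Bool) → Set
Partition p m = ∀ u → 𝟙 (p u) + 𝟙 (m u) ≡ 1

term≤foldr : ∀ {_∙_ : ℕ → ℕ → ℕ} e → (∀ x y → x ≤ x ∙ y) → (∀ x y → x ≤ y ∙ x) →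
             ∀ {n} (g : Fin n → ℕ) i → g i ≤ Vector.foldr _∙_ e g
term≤foldr e ≤ˡ ≤ʳ g zero    = ≤ˡ _ _
term≤foldr e ≤ˡ ≤ʳ g (suc i) = ≤-trans (term≤foldr e ≤ˡ ≤ʳ (g ∘ suc) i) (≤ʳ _ _)

sum-mono-≤ : ∀ {n} {g h : Fin n → ℕ} → (∀ i → g i ≤ h i) → sum g ≤ sum h
sum-mono-≤ {zero}  _   = z≤n
sum-mono-≤ {suc n} g≤h = +-mono-≤ (g≤h zero) (sum-mono-≤ (g≤h ∘ suc))

sum-𝟙-at : ∀ {n} (q : Fin n → Bool) v → sum (λ u → 𝟙 (does (u ≟ᶠ v) ∧ q u)) ≡ 𝟙 (q v)
sum-𝟙-at {suc n} q zero    = trans (cong (_+_ (𝟙 (q zero))) (sum-replicate-zero n)) (+-identityʳ _)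
sum-𝟙-at {suc n} q (suc v) = sum-𝟙-at (q ∘ suc) v

sum-partition : ∀ {n} (p m : Fin n → Bool) → Partition p m → (g : Fin n → ℕ) →
                sum g ≡ sum (λ u → 𝟙 (p u) * g u) + sum (λ u → 𝟙 (m u) * g u)
sum-partition p m part g = begin
  sum g                                      ≡⟨ sum-cong-≗ (λ u → sym (trans (cong (_* g u) (part u)) (*-identityˡ (g u)))) ⟩
  sum (λ u → (𝟙 (p u) + 𝟙 (m u)) * g u)      ≡⟨ sum-cong-≗ (λ u → *-distribʳ-+ (g u) (𝟙 (p u)) (𝟙 (m u))) ⟩
  sum (λ u → 𝟙 (p u) * g u + 𝟙 (m u) * g u)  ≡⟨ ∑-distrib-+ (λ u → 𝟙 (p u) * g u) (λ u → 𝟙 (m u) * g u) ⟩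
  sum (λ u → 𝟙 (p u) * g u) + sum (λ u → 𝟙 (m u) * g u) ∎
  where open ≡-Reasoning

sum-symmetric≡2*sum-< : ∀ {n} (g : Fin n → Fin n → Bool) → (∀ u v → g u v ≡ g v u) → (∀ u → g u u ≡ false) →
                        (sum λ u → sum λ v → 𝟙 (g u v)) ≡ 2 * (sum λ u → sum λ v → 𝟙 (does (u <? v) ∧ g u v))
sum-symmetric≡2*sum-< {n} g g-sym g-irrefl = begin
  (sum λ u → sum λ v → 𝟙 (g u v))                  ≡⟨ sum-cong-≗ (λ u → trans (sum-cong-≗ (split u)) (∑-distrib-+ (A u) (λ v → A v u))) ⟩
  (sum λ u → sum (A u) + sum λ v → A v u)           ≡⟨ ∑-distrib-+ (λ u → sum (A u)) (λ u → sum λ v → A v u) ⟩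
  X + (sum λ u → sum λ v → A v u)                   ≡⟨ cong (_+_ X) (∑-comm (λ u v → A v u)) ⟩
  X + X                                             ≡⟨ cong (_+_ X) (sym (+-identityʳ X)) ⟩
  2 * X                                             ∎
  where
  open ≡-Reasoning
  A : Fin n → Fin n → ℕ
  A u v = 𝟙 (does (u <? v) ∧ g u v)
  X = sum λ u → sum (A u)
  split : ∀ u v → 𝟙 (g u v) ≡ A u v + A v u
  split u v with FinP.<-cmp u v
  ... | tri< u<v _ _ rewrite dec-true (u <? v) u<v | dec-false (v <? u) (FinP.<-asym u<v) = sym (+-identityʳ _)
  ... | tri≈ _ refl _ rewrite dec-false (u <? u) (FinP.<-irrefl refl) | g-irrefl u = refl
  ... | tri> _ _ v<u rewrite dec-false (u <? v) (FinP.<-asym v<u) | dec-true (v <? u) v<u = cong 𝟙 (g-sym u v)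

foldr-map-allFin : ∀ {A B : Set} (_∙_ : A → B → B) e {n} (g : Fin n → A) →
                   List.foldr _∙_ e (List.map g (List.allFin n)) ≡ Vector.foldr _∙_ e g
foldr-map-allFin _∙_ e g = trans (cong (List.foldr _∙_ e) (map-tabulate id g)) (foldr-tabulate g)
  where
  foldr-tabulate : ∀ {n} (h : Fin n → _) → List.foldr _∙_ e (List.tabulate h) ≡ Vector.foldr _∙_ e h
  foldr-tabulate {zero}  h = refl
  foldr-tabulate {suc n} h = cong (h zero ∙_) (foldr-tabulate (h ∘ suc))

length-filter≡sum-𝟙 : ∀ {A : Set} (p : A → Bool) (xs : List A) →
                      List.length (List.filter (λ x → p x ≟ᵇ true) xs) ≡ List.foldr _+_ 0 (List.map (𝟙 ∘ p) xs)
length-filter≡sum-𝟙 p []       = refl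
length-filter≡sum-𝟙 p (x ∷ xs) with p x
... | true  = cong suc (length-filter≡sum-𝟙 p xs)
... | false = length-filter≡sum-𝟙 p xs

count≡sum : ∀ {n} (p : Fin n → Bool) → count p ≡ sum (𝟙 ∘ p)
count≡sum {n} p = trans (length-filter≡sum-𝟙 p (List.allFin n)) (foldr-map-allFin _+_ 0 (𝟙 ∘ p))

count₂≡sum : ∀ {n} (p : Fin n → Fin n → Bool) → count₂ p ≡ (sum λ u → sum λ v → 𝟙 (p u v))
count₂≡sum p = trans (foldr-map-allFin _+_ 0 (count ∘ p)) (sum-cong-≗ (count≡sum ∘ p))

pos-sum : ∀ {n} (g : Fin n → ℕ) → + sum g ≡ ℤΣ.sum (+_ ∘ g)
pos-sum {zero}  g = refl
pos-sum {suc n} g = trans (ℤ.pos-+ (g zero) (sum (g ∘ suc))) (cong (+ g zero +ℤ_) (pos-sum (g ∘ suc)))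

m+m≤n⇒m≤⌊n/2⌋ : ∀ {m n} → m + m ≤ n → m ≤ ⌊ n /2⌋
m+m≤n⇒m≤⌊n/2⌋ {m} le = subst (_≤ _) (sym (n≡⌊n+n/2⌋ m)) (⌊n/2⌋-mono le)

2+n≤m+m⇒⌈n/2⌉<m : ∀ {n m} → 2 + n ≤ m + m → ⌈ n /2⌉ < m
2+n≤m+m⇒⌈n/2⌉<m {zero}        {suc m}       _  = s≤s z≤n
2+n≤m+m⇒⌈n/2⌉<m {suc zero}    {suc (suc m)} _  = s≤s (s≤s z≤n)
2+n≤m+m⇒⌈n/2⌉<m {suc zero}    {suc zero}    (s≤s (s≤s ()))
2+n≤m+m⇒⌈n/2⌉<m {suc (suc n)} {suc m}       (s≤s le) =
  s≤s (2+n≤m+m⇒⌈n/2⌉<m (≤-pred (subst (3 + n ≤_) (+-suc m m) le)))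

odd-slack : ∀ {a x y} → 2 * a + x ≤ y → 𝟙 (does ((y + x) % 2 ≟ 1)) + 2 * a + x ≤ y
odd-slack {a} {x} {y} le = slack ((y + x) % 2 ≟ 1)
  where
  even : (2 * a + x + x) % 2 ≡ 0
  even = trans (cong (_% 2) 2a+x+x≡[a+x]*2) (m*n%n≡0 (a + x) 2)
    where
    2a+x+x≡[a+x]*2 : 2 * a + x + x ≡ (a + x) * 2
    2a+x+x≡[a+x]*2 = solve (a ∷ x ∷ [])
  slack : (odd? : Dec ((y + x) % 2 ≡ 1)) → 𝟙 (does odd?) + 2 * a + x ≤ y
  slack (no _) = le
  slack (yes odd) with m≤n⇒m<n∨m≡n le
  ... | inj₁ lt   = lt
  ... | inj₂ refl = contradiction (trans (sym odd) even) λ ()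

1+𝟙m+x≤𝟙p+y⇒2*𝟙m+x≤y : ∀ {p m : Bool} {x y} → 𝟙 p + 𝟙 m ≡ 1 → 1 + (𝟙 m + x) ≤ 𝟙 p + y → 2 * 𝟙 m + x ≤ y
1+𝟙m+x≤𝟙p+y⇒2*𝟙m+x≤y {true}  {false} _ (s≤s le) = le
1+𝟙m+x≤𝟙p+y⇒2*𝟙m+x≤y {false} {true}  _ le       = le

m+n≤o⇒+m≤+o-+n : ∀ {m n o} → m + n ≤ o → + m ≤ℤ + o -ℤ + n
m+n≤o⇒+m≤+o-+n {m} {n} {o} le =
  subst (+ m ≤ℤ_) (sym (trans (ℤ.[+m]-[+n]≡m⊖n o n) (ℤ.⊖-≥ (≤-trans (m≤n+m n m) le))))
        (+≤+ (m+n≤o⇒m≤o∸n m le))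

degree≤maxDegree : ∀ {n} (G : Graph n) v → degree G v ≤ maxDegree G
degree≤maxDegree {n} G v =
  subst (degree G v ≤_) (sym (foldr-map-allFin _⊔_ 0 (degree G))) 
        (term≤foldr 0 m≤m⊔n (λ x y → m≤n⊔m y x) (degree G) v)

module _ {n} (G : Graph n) where

  degIn : (Fin n → Bool) → Fin n → ℕ
  degIn q v = sum λ u → 𝟙 (adj G v u ∧ q u)

  arcs : (Fin n → Bool) → (Fin n → Bool) → ℕ
  arcs p q = count₂ λ u v → adj G u v ∧ p u ∧ q v

  1≤degIn : ∀ q {u v} → adj G u v ≡ true → q v ≡ true → 1 ≤ degIn q u
  1≤degIn q {u} {v} uv qv =
    subst (_≤ degIn q u) (cong₂ (λ a b → 𝟙 (a ∧ b)) uv qv) (term≤foldr 0 m≤m+n m≤n+m (λ w → 𝟙 (adj G u w ∧ q w)) v)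

  degree≡degIn+degIn : ∀ p m → Partition p m → ∀ v → degree G v ≡ degIn p v + degIn m v
  degree≡degIn+degIn p m part v = begin
    degree G v                                       ≡⟨ count≡sum (adj G v) ⟩
    sum (𝟙 ∘ adj G v)                                ≡⟨ sum-partition p m part (𝟙 ∘ adj G v) ⟩
    sum (λ u → 𝟙 (p u) * 𝟙 (adj G v u)) + sum (λ u → 𝟙 (m u) * 𝟙 (adj G v u))
                                                     ≡⟨ cong₂ _+_ (sum-cong-≗ (restrict p)) (sum-cong-≗ (restrict m)) ⟩
    degIn p v + degIn m v                            ∎
    where
    open ≡-Reasoning
    restrict : ∀ q u → 𝟙 (q u) * 𝟙 (adj G v u) ≡ 𝟙 (adj G v u ∧ q u)
    restrict q u = trans (*-comm (𝟙 (q u)) _) (sym (𝟙-∧ (adj G v u) (q u)))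

  closedNbhd-𝟙 : ∀ q v → sum (λ u → 𝟙 ((does (u ≟ᶠ v) ∨ adj G v u) ∧ q u)) ≡ 𝟙 (q v) + degIn q v
  closedNbhd-𝟙 q v =
    trans (sum-cong-≗ split) (trans (∑-distrib-+ (λ u → 𝟙 (does (u ≟ᶠ v) ∧ q u)) (λ u → 𝟙 (adj G v u ∧ q u)))
      (cong (_+ degIn q v) (sum-𝟙-at q v)))
    where
    split : ∀ u → 𝟙 ((does (u ≟ᶠ v) ∨ adj G v u) ∧ q u) ≡ 𝟙 (does (u ≟ᶠ v) ∧ q u) + 𝟙 (adj G v u ∧ q u)
    split u with u ≟ᶠ v
    ... | yes refl rewrite irrefl G u = sym (+-identityʳ _)
    ... | no _ = refl

  closedNbhdSum-counts : ∀ (f : Fin n → ℤ) → (∀ u → f u ≡ + 1 ⊎ f u ≡ -[1+ 0 ]) → ∀ v →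
    closedNbhdSum G f v +ℤ + (𝟙 (isMinus f v) + degIn (isMinus f) v) ≡ + (𝟙 (isPlus f v) + degIn (isPlus f) v)
  closedNbhdSum-counts f ±1 v = begin
    closedNbhdSum G f v +ℤ + (𝟙 (isMinus f v) + degIn (isMinus f) v)
      ≡⟨ cong₂ _+ℤ_ (foldr-map-allFin _+ℤ_ (+ 0) h) (cong +_ (sym (closedNbhd-𝟙 (isMinus f) v))) ⟩
    ℤΣ.sum h +ℤ + sum (inN[v] (isMinus f))
      ≡⟨ cong (ℤΣ.sum h +ℤ_) (pos-sum (inN[v] (isMinus f))) ⟩
    ℤΣ.sum h +ℤ ℤΣ.sum (+_ ∘ inN[v] (isMinus f))
      ≡⟨ sym (ℤΣ.∑-distrib-+ h (+_ ∘ inN[v] (isMinus f))) ⟩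
    ℤΣ.sum (λ u → h u +ℤ + inN[v] (isMinus f) u)
      ≡⟨ ℤΣ.sum-cong-≗ (λ u → signed (does (u ≟ᶠ v) ∨ adj G v u) (±1 u)) ⟩
    ℤΣ.sum (+_ ∘ inN[v] (isPlus f))
      ≡⟨ sym (pos-sum (inN[v] (isPlus f))) ⟩
    + sum (inN[v] (isPlus f))
      ≡⟨ cong +_ (closedNbhd-𝟙 (isPlus f) v) ⟩
    + (𝟙 (isPlus f v) + degIn (isPlus f) v) ∎
    where
    open ≡-Reasoning
    h : Fin n → ℤ
    h u = if does (u ≟ᶠ v) ∨ adj G v u then f u else + 0
    inN[v] : (Fin n → Bool) → Fin n → ℕ
    inN[v] q u = 𝟙 ((does (u ≟ᶠ v) ∨ adj G v u) ∧ q u)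
    signed : ∀ b {x} → x ≡ + 1 ⊎ x ≡ -[1+ 0 ] →
             (if b then x else + 0) +ℤ + 𝟙 (b ∧ does (x ≟ℤ -[1+ 0 ])) ≡ + 𝟙 (b ∧ does (x ≟ℤ + 1))
    signed true  (inj₁ refl) = refl
    signed true  (inj₂ refl) = refl
    signed false _           = refl

  arcs≡sum-𝟙*degIn : ∀ p q → arcs p q ≡ sum λ u → 𝟙 (p u) * degIn q u
  arcs≡sum-𝟙*degIn p q = trans (count₂≡sum (λ u v → adj G u v ∧ p u ∧ q v)) (sum-cong-≗ λ u →
    trans (sum-cong-≗ (λ v → 𝟙-∧-middle (adj G u v) (p u) (q v)))
          (sym (*-distribˡ-sum (𝟙 (p u)) (λ v → 𝟙 (adj G u v ∧ q v)))))

  arcs-comm : ∀ p q → arcs p q ≡ arcs q p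
  arcs-comm p q = begin
    arcs p q                                                 ≡⟨ count₂≡sum (λ u v → adj G u v ∧ p u ∧ q v) ⟩
    (sum λ u → sum λ v → 𝟙 (adj G u v ∧ p u ∧ q v))          ≡⟨ ∑-comm (λ u v → 𝟙 (adj G u v ∧ p u ∧ q v)) ⟩
    (sum λ v → sum λ u → 𝟙 (adj G u v ∧ p u ∧ q v))          ≡⟨ sum-cong-≗ (λ v → sum-cong-≗ (λ u → cong 𝟙 (reverse u v))) ⟩
    (sum λ v → sum λ u → 𝟙 (adj G v u ∧ q v ∧ p u))          ≡⟨ sym (count₂≡sum (λ v u → adj G v u ∧ q v ∧ p u)) ⟩
    arcs q p                                                 ∎
    where
    open ≡-Reasoning
    reverse : ∀ u v → adj G u v ∧ p u ∧ q v ≡ adj G v u ∧ q v ∧ p u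
    reverse u v = cong₂ _∧_ (Graph.sym G u v) (∧-comm (p u) (q v))

  arcs≡2*edges : ∀ q → arcs q q ≡ 2 * count₂ (λ u v → does (u <? v) ∧ adj G u v ∧ q u ∧ q v)
  arcs≡2*edges q = trans (count₂≡sum g) (trans
    (sum-symmetric≡2*sum-< g (λ u v → cong₂ _∧_ (Graph.sym G u v) (∧-comm (q u) (q v)))
                             (λ u → cong (_∧ (q u ∧ q u)) (irrefl G u)))
    (cong (2 *_) (sym (count₂≡sum (λ u v → does (u <? v) ∧ g u v)))))
    where
    g : Fin n → Fin n → Bool
    g u v = adj G u v ∧ q u ∧ q v

  sum-degIn : ∀ p m → Partition p m → ∀ q → sum (degIn q) ≡ arcs p q + arcs m q
  sum-degIn p m part q =
    trans (sum-partition p m part (degIn q)) (sym (cong₂ _+_ (arcs≡sum-𝟙*degIn p q) (arcs≡sum-𝟙*degIn m q)))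

module SignedDominating {n} (G : Graph n) (f : Fin n → ℤ) (sdf : IsSDF G f) where

  d⁺ d⁻ : Fin n → ℕ
  d⁺ = degIn G (isPlus f)
  d⁻ = degIn G (isMinus f)

  partition : Partition (isPlus f) (isMinus f)
  partition v with f v | proj₁ sdf v
  ... | _ | inj₁ refl = refl
  ... | _ | inj₂ refl = refl

  degree≡d⁺+d⁻ : ∀ v → degree G v ≡ d⁺ v + d⁻ v
  degree≡d⁺+d⁻ = degree≡degIn+degIn G (isPlus f) (isMinus f) partition

  2*𝟙⁻+d⁻≤d⁺ : ∀ v → 2 * 𝟙 (isMinus f v) + d⁻ v ≤ d⁺ v
  2*𝟙⁻+d⁻≤d⁺ v = 1+𝟙m+x≤𝟙p+y⇒2*𝟙m+x≤y (partition v) (ℤ.drop‿+≤+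
    (subst₂ _≤ℤ_ (sym (ℤ.pos-+ 1 _)) (closedNbhdSum-counts G f (proj₁ sdf) v) (ℤ.+-monoˡ-≤ _ (proj₂ sdf v))))

  2+d⁻≤d⁺ : ∀ {v} → isMinus f v ≡ true → 2 + d⁻ v ≤ d⁺ v
  2+d⁻≤d⁺ {v} v∈V⁻ = subst (λ b → 2 * 𝟙 b + d⁻ v ≤ d⁺ v) v∈V⁻ (2*𝟙⁻+d⁻≤d⁺ v)

  d⁻+d⁻≤degree : ∀ v → d⁻ v + d⁻ v ≤ degree G v
  d⁻+d⁻≤degree v = ≤-trans (+-monoˡ-≤ (d⁻ v) (≤-trans (m≤n+m (d⁻ v) _) (2*𝟙⁻+d⁻≤d⁺ v)))
                           (≤-reflexive (sym (degree≡d⁺+d⁻ v)))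

  V⁻⊆C : ∀ v → isMinus f v ≡ true → InC G v
  V⁻⊆C v v∈V⁻ = (λ deg≡0 → contradiction (subst (2 ≤_) deg≡0 2≤deg) λ ())
              , (λ deg≡1 → contradiction (subst (2 ≤_) deg≡1 2≤deg) λ { (s≤s ()) })
              , λ (u , vu , deg[u]≡1) → contradiction (subst (2 ≤_) deg[u]≡1 (2≤deg[u] vu)) λ { (s≤s ()) }
    where
    2≤deg : 2 ≤ degree G v
    2≤deg = ≤-trans (≤-trans (m≤m+n 2 (d⁻ v)) (2+d⁻≤d⁺ v∈V⁻))
                    (≤-trans (m≤m+n (d⁺ v) (d⁻ v)) (≤-reflexive (sym (degree≡d⁺+d⁻ v))))
    2≤deg[u] : ∀ {u} → adj G v u ≡ true → 2 ≤ degree G u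
    2≤deg[u] {u} vu = ≤-trans (+-mono-≤ 1≤d⁻ 1≤d⁻) (d⁻+d⁻≤degree u)
      where
      1≤d⁻ : 1 ≤ d⁻ u
      1≤d⁻ = 1≤degIn G (isMinus f) (trans (Graph.sym G u v) vu) v∈V⁻

  cut≡sum-V⁺-d⁻ : cutSize G f ≡ sum λ u → 𝟙 (isPlus f u) * d⁻ u
  cut≡sum-V⁺-d⁻ = arcs≡sum-𝟙*degIn G (isPlus f) (isMinus f)

  cut≡sum-V⁻-d⁺ : cutSize G f ≡ sum λ v → 𝟙 (isMinus f v) * d⁺ v
  cut≡sum-V⁻-d⁺ = trans (arcs-comm G (isPlus f) (isMinus f)) (arcs≡sum-𝟙*degIn G (isMinus f) (isPlus f))

  cut-lower : ∀ δ → IsDeltaStar G δ → (⌈ δ /2⌉ + 1) * nMinus f ≤ cutSize G f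
  cut-lower δ (_ , δ≤C) = begin
    c * nMinus f                             ≡⟨ *-comm c _ ⟩
    nMinus f * c                             ≡⟨ cong (_* c) (count≡sum (isMinus f)) ⟩
    sum (𝟙 ∘ isMinus f) * c                  ≡⟨ *-distribʳ-sum c (𝟙 ∘ isMinus f) ⟩
    sum (λ v → 𝟙 (isMinus f v) * c)          ≤⟨ sum-mono-≤ (λ v → 𝟙*-mono (isMinus f v) (c≤d⁺ v)) ⟩
    sum (λ v → 𝟙 (isMinus f v) * d⁺ v)       ≡⟨ sym cut≡sum-V⁻-d⁺ ⟩
    cutSize G f                              ∎
    where
    open ≤-Reasoning
    c = ⌈ δ /2⌉ + 1
    c≤d⁺ : ∀ v → isMinus f v ≡ true → c ≤ d⁺ v
    c≤d⁺ v v∈V⁻ = subst (_≤ d⁺ v) (+-comm 1 _) (2+n≤m+m⇒⌈n/2⌉<m (begin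
      2 + δ                ≤⟨ +-monoʳ-≤ 2 (δ≤C v (V⁻⊆C v v∈V⁻)) ⟩
      2 + degree G v       ≡⟨ cong (_+_ 2) (trans (degree≡d⁺+d⁻ v) (+-comm (d⁺ v) (d⁻ v))) ⟩
      2 + (d⁻ v + d⁺ v)    ≡⟨ sym (+-assoc 2 (d⁻ v) (d⁺ v)) ⟩
      2 + d⁻ v + d⁺ v      ≤⟨ +-monoˡ-≤ (d⁺ v) (2+d⁻≤d⁺ v∈V⁻) ⟩
      d⁺ v + d⁺ v          ∎))

  d⁻≤𝟙[non-leaf]*⌊Δ/2⌋ : ∀ u → d⁻ u ≤ 𝟙 (not (isLeafB G u)) * ⌊ maxDegree G /2⌋
  d⁻≤𝟙[non-leaf]*⌊Δ/2⌋ u = bound (degree G u ≟ 1)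
    where
    d⁻≤⌊deg/2⌋ : d⁻ u ≤ ⌊ degree G u /2⌋
    d⁻≤⌊deg/2⌋ = m+m≤n⇒m≤⌊n/2⌋ (d⁻+d⁻≤degree u)
    bound : (leaf? : Dec (degree G u ≡ 1)) → d⁻ u ≤ 𝟙 (not (does leaf?)) * ⌊ maxDegree G /2⌋
    bound (yes deg≡1) = subst (λ d → d⁻ u ≤ ⌊ d /2⌋) deg≡1 d⁻≤⌊deg/2⌋
    bound (no _)      = ≤-trans d⁻≤⌊deg/2⌋
      (≤-trans (⌊n/2⌋-mono (degree≤maxDegree G u)) (≤-reflexive (sym (*-identityˡ _))))

  cut-upper : cutSize G f ≤ ⌊ maxDegree G /2⌋ * nPlusNonLeaf G f
  cut-upper = begin
    cutSize G f                                               ≡⟨ cut≡sum-V⁺-d⁻ ⟩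
    sum (λ u → 𝟙 (isPlus f u) * d⁻ u)                         ≤⟨ sum-mono-≤ (λ u → 𝟙*-mono (isPlus f u) λ _ → d⁻≤𝟙[non-leaf]*⌊Δ/2⌋ u) ⟩
    sum (λ u → 𝟙 (isPlus f u) * (𝟙 (not (isLeafB G u)) * c)) ≡⟨ sum-cong-≗ reassoc ⟩
    sum (λ u → 𝟙 (V⁺∖L u) * c)                                ≡⟨ sym (*-distribʳ-sum c (𝟙 ∘ V⁺∖L)) ⟩
    sum (𝟙 ∘ V⁺∖L) * c                                        ≡⟨ cong (_* c) (sym (count≡sum V⁺∖L)) ⟩
    nPlusNonLeaf G f * c                                      ≡⟨ *-comm _ c ⟩
    c * nPlusNonLeaf G f                                      ∎
    where
    open ≤-Reasoning
    c = ⌊ maxDegree G /2⌋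
    V⁺∖L : Fin n → Bool
    V⁺∖L u = isPlus f u ∧ not (isLeafB G u)
    reassoc : ∀ u → 𝟙 (isPlus f u) * (𝟙 (not (isLeafB G u)) * c) ≡ 𝟙 (V⁺∖L u) * c
    reassoc u = sym (trans (cong (_* c) (𝟙-∧ (isPlus f u) (not (isLeafB G u)))) (*-assoc (𝟙 (isPlus f u)) _ c))

  𝟙odd+2*𝟙⁻+d⁻≤d⁺ : ∀ v → 𝟙 (isOddB G v) + 2 * 𝟙 (isMinus f v) + d⁻ v ≤ d⁺ v
  𝟙odd+2*𝟙⁻+d⁻≤d⁺ v = subst (λ d → 𝟙 (does (d % 2 ≟ 1)) + 2 * 𝟙 (isMinus f v) + d⁻ v ≤ d⁺ v)
                            (sym (degree≡d⁺+d⁻ v)) (odd-slack {𝟙 (isMinus f v)} (2*𝟙⁻+d⁻≤d⁺ v))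

  sum-d⁺ : sum d⁺ ≡ 2 * ePlus G f + cutSize G f
  sum-d⁺ = trans (sum-degIn G (isPlus f) (isMinus f) partition (isPlus f))
                 (cong₂ _+_ (arcs≡2*edges G (isPlus f)) (arcs-comm G (isMinus f) (isPlus f)))

  sum-d⁻ : sum d⁻ ≡ cutSize G f + 2 * eMinus G f
  sum-d⁻ = trans (sum-degIn G (isPlus f) (isMinus f) partition (isMinus f))
                 (cong (_+_ (cutSize G f)) (arcs≡2*edges G (isMinus f)))

  odd+2V⁻+2E⁻≤2E⁺ : nOdd G + 2 * nMinus f + 2 * eMinus G f ≤ 2 * ePlus G f
  odd+2V⁻+2E⁻≤2E⁺ = +-cancelʳ-≤ (cutSize G f) _ _ (begin
    nOdd G + 2 * nMinus f + 2 * eMinus G f + cutSize G f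
      ≡⟨ trans (+-assoc (nOdd G + 2 * nMinus f) _ _) (cong (_+_ (nOdd G + 2 * nMinus f)) (+-comm (2 * eMinus G f) _)) ⟩
    nOdd G + 2 * nMinus f + (cutSize G f + 2 * eMinus G f)
      ≡⟨ cong₂ _+_ (cong₂ _+_ (count≡sum (isOddB G))
                              (trans (cong (2 *_) (count≡sum (isMinus f))) (*-distribˡ-sum 2 (𝟙 ∘ isMinus f))))
                   (sym sum-d⁻) ⟩
    sum 𝟙odd + sum (λ v → 2 * 𝟙 (isMinus f v)) + sum d⁻
      ≡⟨ cong (_+ sum d⁻) (sym (∑-distrib-+ 𝟙odd (λ v → 2 * 𝟙 (isMinus f v)))) ⟩
    sum (λ v → 𝟙odd v + 2 * 𝟙 (isMinus f v)) + sum d⁻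
      ≡⟨ sym (∑-distrib-+ (λ v → 𝟙odd v + 2 * 𝟙 (isMinus f v)) d⁻) ⟩
    sum (λ v → 𝟙odd v + 2 * 𝟙 (isMinus f v) + d⁻ v)
      ≤⟨ sum-mono-≤ 𝟙odd+2*𝟙⁻+d⁻≤d⁺ ⟩
    sum d⁺
      ≡⟨ sum-d⁺ ⟩
    2 * ePlus G f + cutSize G f ∎)
    where
    open ≤-Reasoning
    𝟙odd : Fin n → ℕ
    𝟙odd = 𝟙 ∘ isOddB G

lemma3p1 : ∀ (n : ℕ) (G : Graph n) (f : Fin n → ℤ) (δ* : ℕ)
    → Connected G
    → (∃ λ v → InC G v)
    → IsDeltaStar G δ*
    → IsSDF G f
    → ((⌈ δ* /2⌉ + 1) * nMinus f ≤ cutSize G f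
    × cutSize G f ≤ ⌊ maxDegree G /2⌋ * nPlusNonLeaf G f)
    × (+ (nOdd G + 2 * nMinus f) ≤ℤ (+ 2 *ℤ + ePlus G f) -ℤ (+ 2 *ℤ + eMinus G f))
lemma3p1 n G f δ* _ _ δ*-min sdf =
  (cut-lower δ* δ*-min , cut-upper) ,
  subst₂ (λ x y → + (nOdd G + 2 * nMinus f) ≤ℤ x -ℤ y) (ℤ.pos-* 2 (ePlus G f)) (ℤ.pos-* 2 (eMinus G f))
         (m+n≤o⇒+m≤+o-+n odd+2V⁻+2E⁻≤2E⁺)
  where open SignedDominating G f sdf
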